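{- Let $p\geq 2$ and let $q'$ be an integer with $1\leq q'\leq\lceil\log_2 p\rceil$. Run the $q'$-doubling exclusive scan algorithm (described in the context) on $p$ processors with inputs $V_0,\dots,V_{p-1}$ and an associative binary operator $\oplus$. Then it solves the exclusive scan problem: at termination, for every $r$ with $1\leq r\leq p-1$, the variable $W$ of processor $r$ equals $V_0\oplus V_1\oplus\cdots\oplus V_{r-1}$. It uses $$q=\left\lceil \log_2(p-1)+\log_2\frac{2^{q'}}{2^{q'}-1}\right\rceil=\left\lceil\log_2\left(\frac{2^{q'}}{2^{q'}-1}(p-1)\right)\right\rceil$$ simultaneous send-receive communication rounds, and every processor performs at most $q+q'-2$ applications of $\oplus$.
   Context: Model: there are $p$ processors ranked $0,1,\dots,p-1$. Processor $r$ holds an input vector $V_r$. $\oplus$ is an associative (not necessarily commutative, not necessarily invertible) binary operator on vectors. Computation proceeds in communication rounds. In each round, every processor may simultaneously send one vector to one processor and receive one vector from one processor. An application of $\oplus$ means one evaluation $X\oplus Y$ of two vectors. The exclusive scan problem asks each processor $r\geq 1$ to compute $W_r=\bigoplus_{i=0}^{r-1}V_i$ (in rank order). The $q'$-doubling exclusive scan algorithm sets $p'=2^{q'}$. Processor $r$ executes the following. Initial round (skip $s=1$). If $r+1<p$, send $V$ to $r+1$. If $r-1\geq 0$, receive a vector from $r-1$ into $W$. These are done simultaneously when both apply. Then set $s\gets 2s$. Inclusive phase: while $s<p'$, with $t=r+s$ and $f=r-s$: - If $f\geq 0$ and $t<p$: compute $W'=W\oplus V$; simultaneously send $W'$ to $t$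 and receive $T$ from $f$; then set $W\gets T\oplus W$. - Else if $f\geq 0$: receive $T$ from $f$ and set $W\gets T\oplus W$. - Else if $r>0$ and $t<p$: send $W'=W\oplus V$ to $t$. This $W'$ is computed at most once, since $W$ no longer changes. - Else if $r=0$ and $t<p$: send $V$ to $t$. Then set $s\gets 2s$. Adjustment: after the inclusive phase, set $s\gets s-1$. Exclusive phase: while $s<p-1$, with $t=r+s$ and $f=r-s$: - If $f\geq 1$ and $t<p$: simultaneously send $W$ to $t$ and receive $T$ from $f$; then set $W\gets T\oplus W$. - Else if $f\geq 1$: receive $T$ from $f$ and set $W\gets T\oplus W$. - Else if $r\geq 1$ and $t<p$: send $W$ to $t$. Then set $s\gets 2s$. -}

module Defs where

open import Level using (Level)
open import Data.Nat.Base using (ℕ; zero; suc; _+_; _*_; _∸_; _^_; _≤_; _<ᵇ_; _≤ᵇ_; _≡ᵇ_)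
open import Data.Bool.Base using (Bool; true; false; if_then_else_; _∧_)
open import Data.Maybe.Base using (Maybe; just; nothing; maybe)
open import Data.Product.Base using (_×_; _,_; proj₁; proj₂)
open import Data.List.Base using (List; []; _∷_; length; foldl; map; _++_)
open import Algebra.Bundles using (Semigroup)

-- Arithmetic notion used in the round count.
-- CeilLog2 a b q : q is the least natural number with a ≤ 2^q * b,
-- i.e. q = ⌈ log₂ (a / b) ⌉ for a rational a/b > 1 (b > 0).

CeilLog2 : ℕ → ℕ → ℕ → Set
CeilLog2 a b q = (a ≤ 2 ^ q * b) × (∀ k → a ≤ 2 ^ k * b → q ≤ k)

data Phase : Set where
  initial inclusive exclusive : Phase

-- "while s < bound do { emit s ; s ← 2s }", run with a fuel bound
-- (the fuel used below is always large enough since s ≥ 1).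
whileDoubling : (fuel bound s : ℕ) → List ℕ × ℕ
whileDoubling zero    bound s = [] , s
whileDoubling (suc k) bound s =
  if s <ᵇ bound
  then (let rec = whileDoubling k bound (2 * s) in (s ∷ proj₁ rec) , proj₂ rec)
  else ([] , s)

schedule : (p q' : ℕ) → List (Phase × ℕ)
schedule p q' =
  let p'   = 2 ^ q'
      inc  = whileDoubling p' p' (2 * 1)          -- s ← 2s after initial round
      s₀   = proj₂ inc ∸ 1
      exc  = whileDoubling p (p ∸ 1) s₀
  in  (initial , 1) ∷ (map (inclusive ,_) (proj₁ inc) ++ map (exclusive ,_) (proj₁ exc))

module Algorithm {c ℓ : Level} (S : Semigroup c ℓ) where
  open Semigroup S renaming (Carrier to C; _∙_ to _⊕_)

  -- nothing = undefined contents (e.g. W on processor 0, or a value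
  -- obtained from a failed/mismatched receive)
  _⊕?_ : Maybe C → Maybe C → Maybe C
  just x ⊕? just y = just (x ⊕ y)
  _      ⊕? _      = nothing

  record Proc : Set c where
    field
      W     : Maybe C
      cache : Maybe (Maybe C)   -- the once-computed W' = W ⊕ V (inclusive phase, 3rd case)
      ops   : ℕ                 -- number of applications of ⊕ performed so far
  open Proc public

  initProc : Proc
  initProc = record { W = nothing ; cache = nothing ; ops = 0 }

  -- a sent message: destination rank and contents
  Msg : Set c
  Msg = Maybe (ℕ × Maybe C)

  sendPart : Phase → (p s r : ℕ) → C → Proc → Msg × Proc
  sendPart initial p s r v st =
    if suc r <ᵇ p then (just (suc r , just v) , st) else (nothing , st)
  sendPart inclusive p s r v st =
    let t = r + s in
    if (s ≤ᵇ r) ∧ (t <ᵇ p)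
      then (let W' = W st ⊕? just v in
            (just (t , W') , record st { ops = suc (ops st) }))
    else if s ≤ᵇ r then (nothing , st)
    else if (1 ≤ᵇ r) ∧ (t <ᵇ p)
      then maybe (λ W' → (just (t , W') , st))
                 (let W' = W st ⊕? just v in
                  (just (t , W') , record st { cache = just W' ; ops = suc (ops st) }))
                 (cache st)
    else if (r ≡ᵇ 0) ∧ (t <ᵇ p) then (just (t , just v) , st)
    else (nothing , st)
  sendPart exclusive p s r v st =
    let t = r + s in
    if (suc s ≤ᵇ r) ∧ (t <ᵇ p) then (just (t , W st) , st)
    else if suc s ≤ᵇ r then (nothing , st)
    else if (1 ≤ᵇ r) ∧ (t <ᵇ p) then (just (t , W st) , st)
    else (nothing , st)

  source : Phase → (s r : ℕ) → Maybe ℕ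
  source initial   s r = if 1 ≤ᵇ r then just (r ∸ 1) else nothing
  source inclusive s r = if s ≤ᵇ r then just (r ∸ s) else nothing
  source exclusive s r = if suc s ≤ᵇ r then just (r ∸ s) else nothing

  deliver : ℕ → Msg → Maybe C
  deliver r (just (d , x)) = if d ≡ᵇ r then x else nothing
  deliver r nothing        = nothing

  recvPart : Phase → Maybe C → Proc → Proc
  recvPart initial   T st = record st { W = T }
  recvPart inclusive T st = record st { W = T ⊕? W st ; ops = suc (ops st) }
  recvPart exclusive T st = record st { W = T ⊕? W st ; ops = suc (ops st) }

  step : (p : ℕ) → (ℕ → C) → Phase × ℕ → (ℕ → Proc) → (ℕ → Proc)
  step p V (ph , s) G r =
    let st' = proj₂ (sendPart ph p s r (V r) (G r)) in
    maybe (λ f → recvPart ph (deliver r (proj₁ (sendPart ph p s f (V f) (G f)))) st')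
          st'
          (source ph s r)

  run : (p q' : ℕ) → (ℕ → C) → (ℕ → Proc)
  run p q' V = foldl (λ G e → step p V e G) (λ _ → initProc) (schedule p q')

  rounds : (p q' : ℕ) → ℕ
  rounds p q' = length (schedule p q')

  prefix : (ℕ → C) → ℕ → C
  prefix V zero    = V 0
  prefix V (suc n) = prefix V n ⊕ V (suc n)

module Submission where

open import Defs
open import Level using (Level; _⊔_)
open import Algebra.Bundles using (Semigroup)
open import Data.Nat.Base hiding (_⊔_)
open import Data.Nat.Properties
open import Data.Nat.Logarithm using (⌈log₂_⌉; ⌈log₂⌉-mono-≤; ⌈log₂2^n⌉≡n)
open import Data.Nat.Tactic.RingSolver using (solve-∀)
open import Data.Bool.Base using (true; false)
open import Data.Unit.Polymorphic using (⊤)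
open import Data.Empty.Polymorphic using (⊥)
open import Data.Maybe.Base using (Maybe; just; nothing; maybe)
open import Data.Maybe.Relation.Binary.Pointwise using (Pointwise; just)
open import Data.Product.Base using (_×_; _,_; proj₁; proj₂; ∃-syntax)
open import Data.Sum.Base using (_⊎_; inj₁; inj₂)
open import Data.List.Base using (List; []; _∷_; _++_; foldl; map; length)
open import Data.List.Properties using (foldl-++; length-++; length-map)
open import Relation.Nullary using (yes; no; contradiction)
open import Relation.Nullary.Reflects using (ofʸ; ofⁿ)
open import Relation.Binary.PropositionalEquality using (_≡_; refl; sym; trans; cong; cong₂; subst)

-- Write [a, b) for V a ⊕ ⋯ ⊕ V (b - 1), with a truncated at 0. Before the inclusive
-- round with skip s, processor r holds [r + 1 - s, r) in W, and its cache, once set,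
-- holds [0, r + 1). In that round r sends [r + 1 - s, r + 1) to r + s (processors
-- r < s reuse the cached value) and prepends what it receives, so afterwards W is
-- [r + 1 - 2s, r); only associativity is used. The inclusive phase ends with skip
-- 2^q', and s ↦ s - 1 rewrites the invariant as W = [r - s, r), which every
-- exclusive round doubles in the same way until s ≥ p - 1, where W = [0, r). The
-- exclusive skips are (2^q' - 1) 2^j, so there are ⌈log₂ ((p - 1) / (2^q' - 1))⌉
-- exclusive rounds, and with the q' earlier rounds this is q because 2^(q' - 1) < p.
-- An inclusive round costs at most two applications of ⊕ and an exclusive one at
-- most one, in total 2 (q' - 1) + (q - q') = q + q' - 2.

-- Arithmetic and ceiling logarithms

2^n*2s≡2^[1+n]*s : ∀ n s → 2 ^ n * (2 * s) ≡ 2 ^ suc n * s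
2^n*2s≡2^[1+n]*s n s = trans (sym (*-assoc (2 ^ n) 2 s)) (cong (_* s) (*-comm (2 ^ n) 2))

CeilLog2-unique : ∀ {a b m n} → CeilLog2 a b m → CeilLog2 a b n → m ≡ n
CeilLog2-unique (a≤m , m-least) (a≤n , n-least) = ≤-antisym (m-least _ a≤n) (n-least _ a≤m)

CeilLog2-zero : ∀ {a b} → a ≤ b → CeilLog2 a b 0
CeilLog2-zero {b = b} a≤b = subst (_ ≤_) (sym (*-identityˡ b)) a≤b , λ _ _ → z≤n

CeilLog2-halve : ∀ {a s n} → s < a → CeilLog2 a (2 * s) n → CeilLog2 a s (suc n)
CeilLog2-halve {a} {s} {n} s<a (a≤ , least) = subst (a ≤_) (2^n*2s≡2^[1+n]*s n s) a≤ , lower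
  where
  lower : ∀ k → a ≤ 2 ^ k * s → suc n ≤ k
  lower zero    a≤s = contradiction (subst (a ≤_) (*-identityˡ s) a≤s) (<⇒≱ s<a)
  lower (suc k) a≤  = s≤s (least k (subst (a ≤_) (sym (2^n*2s≡2^[1+n]*s k s)) a≤))

CeilLog2-double : ∀ {a b n} → b < 2 * a → CeilLog2 a b n → CeilLog2 (2 * a) b (suc n)
CeilLog2-double {a} {b} {n} b<2a (a≤ , least) =
  subst (2 * a ≤_) (sym (*-assoc 2 (2 ^ n) b)) (*-monoʳ-≤ 2 a≤) , lower
  where
  lower : ∀ k → 2 * a ≤ 2 ^ k * b → suc n ≤ k
  lower zero    2a≤b = contradiction (subst (2 * a ≤_) (*-identityˡ b) 2a≤b) (<⇒≱ b<2a)
  lower (suc k) 2a≤  = s≤s (least k (*-cancelˡ-≤ 2 (subst (2 * a ≤_) (*-assoc 2 (2 ^ k) b) 2a≤)))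

CeilLog2-2^* : ∀ m {a b n} → b < 2 * a → CeilLog2 a b n → CeilLog2 (2 ^ m * a) b (m + n)
CeilLog2-2^* zero    {a} {b} {n} b<2a c = subst (λ x → CeilLog2 x b n) (sym (*-identityˡ a)) c
CeilLog2-2^* (suc m) {a} {b} {n} b<2a c =
  subst (λ x → CeilLog2 x b (suc m + n)) (sym (*-assoc 2 (2 ^ m) a))
    (CeilLog2-double (<-≤-trans b<2a (*-monoʳ-≤ 2 (m≤n*m a (2 ^ m) {{m^n≢0 2 m}}))) (CeilLog2-2^* m b<2a c))

CeilLog2-2^*-self : ∀ k {b} → 0 < b → CeilLog2 (2 ^ k * b) b k
CeilLog2-2^*-self k {b} 0<b =
  subst (CeilLog2 (2 ^ k * b) b) (+-identityʳ k)
    (CeilLog2-2^* k (m<m+n b (≤-trans 0<b (m≤m+n b 0))) (CeilLog2-zero ≤-refl))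

2^k<p : ∀ {k p} → suc k ≤ ⌈log₂ p ⌉ → 2 ^ k < p
2^k<p {k} {p} k<log = ≰⇒> λ p≤2^k →
  <⇒≱ k<log (≤-trans (⌈log₂⌉-mono-≤ p≤2^k) (≤-reflexive (⌈log₂2^n⌉≡n k)))

n∸1<n : ∀ {n} → 0 < n → n ∸ 1 < n
n∸1<n {suc n} _ = n<1+n n

m<n⇒m≤n∸1 : ∀ {m n} → m < n → m ≤ n ∸ 1
m<n⇒m≤n∸1 (s≤s m≤n) = m≤n

1+[m+n+o]≡m+[1+n+o] : ∀ m n o → suc (m + n + o) ≡ m + suc (n + o)
1+[m+n+o]≡m+[1+n+o] m n o = trans (cong suc (+-assoc m n o)) (sym (+-suc m (n + o)))

m∸n∸n≡m∸2*n : ∀ m n → m ∸ n ∸ n ≡ m ∸ 2 * n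
m∸n∸n≡m∸2*n m n = trans (∸-+-assoc m n n) (cong (λ k → m ∸ (n + k)) (sym (+-identityʳ n)))

m≤n⇒m∸n≡m∸2*n : ∀ {m n} → m ≤ n → m ∸ n ≡ m ∸ 2 * n
m≤n⇒m∸n≡m∸2*n {m} {n} m≤n =
  trans (m≤n⇒m∸n≡0 m≤n) (sym (m≤n⇒m∸n≡0 (≤-trans m≤n (m≤n*m n 2))))

2*k+ne≡[1+k+ne]+[1+k]∸2 : ∀ k ne → 2 * k + ne ≡ suc k + ne + suc k ∸ 2
2*k+ne≡[1+k+ne]+[1+k]∸2 k ne =
  trans (regroup k ne) (cong (_∸ 1) (sym (+-suc (k + ne) k)))
  where
  regroup : ∀ k ne → 2 * k + ne ≡ k + ne + k
  regroup = solve-∀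

-- The schedule in closed form

doublings : ℕ → ℕ → List ℕ
doublings zero    s = []
doublings (suc n) s = s ∷ doublings n (2 * s)

length-doublings : ∀ n s → length (doublings n s) ≡ n
length-doublings zero    s = refl
length-doublings (suc n) s = cong suc (length-doublings n (2 * s))

whileDoubling-doublings : ∀ fuel bound s → 0 < s → bound ≤ fuel + s →
  ∃[ n ] whileDoubling fuel bound s ≡ (doublings n s , 2 ^ n * s) × CeilLog2 bound s n
whileDoubling-doublings zero bound s _ b≤s =
  0 , cong ([] ,_) (sym (*-identityˡ s)) , CeilLog2-zero b≤s
whileDoubling-doublings (suc k) bound s 0<s b≤ with s <ᵇ bound | <ᵇ-reflects-< s bound
... | _ | ofⁿ s≮b = 0 , cong ([] ,_) (sym (*-identityˡ s)) , CeilLog2-zero (≮⇒≥ s≮b)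
... | _ | ofʸ s<b with whileDoubling-doublings k bound (2 * s) (≤-trans 0<s (m≤n*m s 2)) b≤k+2s
  where
  b≤k+2s : bound ≤ k + 2 * s
  b≤k+2s = ≤-trans b≤ (≤-trans (≤-reflexive (sym (+-suc k s)))
                                 (+-monoʳ-≤ k (m<m+n s (≤-trans 0<s (m≤m+n s 0)))))
...   | n , eq , c rewrite eq =
  suc n , cong (s ∷ doublings n (2 * s) ,_) (2^n*2s≡2^[1+n]*s n s) , CeilLog2-halve s<b c

whileDoubling-inclusive : ∀ k → whileDoubling (2 ^ suc k) (2 ^ suc k) 2 ≡ (doublings k 2 , 2 ^ suc k)
whileDoubling-inclusive k
  with whileDoubling-doublings (2 ^ suc k) (2 ^ suc k) 2 (s≤s z≤n) (m≤m+n _ 2)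
... | n , eq , c
  with CeilLog2-unique c (subst (λ a → CeilLog2 a 2 k) (*-comm (2 ^ k) 2) (CeilLog2-2^*-self k (s≤s z≤n)))
...   | refl = trans eq (cong (doublings k 2 ,_) (*-comm (2 ^ k) 2))

-- With k = q' - 1: skips 2, 4, …, 2^(q' - 1), then (2^q' - 1) 2^j for j < ne.
inclusiveRounds : ℕ → List (Phase × ℕ)
inclusiveRounds k = map (inclusive ,_) (doublings k 2)

exclusiveRounds : ℕ → ℕ → List (Phase × ℕ)
exclusiveRounds k ne = map (exclusive ,_) (doublings ne (2 ^ suc k ∸ 1))

doublingSchedule : ℕ → ℕ → List (Phase × ℕ)
doublingSchedule k ne = (initial , 1) ∷ (inclusiveRounds k ++ exclusiveRounds k ne)

length-doublingSchedule : ∀ k ne → length (doublingSchedule k ne) ≡ suc (k + ne)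
length-doublingSchedule k ne = cong suc (trans (length-++ (inclusiveRounds k) {exclusiveRounds k ne})
  (cong₂ _+_ (trans (length-map _ (doublings k 2)) (length-doublings k 2))
             (trans (length-map _ (doublings ne (2 ^ suc k ∸ 1))) (length-doublings ne _))))

schedule-doublingSchedule : ∀ p k →
  ∃[ ne ] schedule p (suc k) ≡ doublingSchedule k ne × CeilLog2 (p ∸ 1) (2 ^ suc k ∸ 1) ne
schedule-doublingSchedule p k
  with whileDoubling-doublings p (p ∸ 1) (2 ^ suc k ∸ 1) (m<n⇒0<n∸m (*-monoʳ-≤ 2 (m^n>0 2 k)))
                                (≤-trans (m∸n≤m p 1) (m≤m+n p _))
... | ne , eq , c = ne , schedule≡ , c
  where
  schedule≡ : schedule p (suc k) ≡ doublingSchedule k ne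
  schedule≡ rewrite whileDoubling-inclusive k | eq = refl

-- Execution of the rounds

module Scan {c ℓ : Level} (S : Semigroup c ℓ) where
  open Semigroup S using (_≈_; assoc; ∙-cong; reflexive)
    renaming (Carrier to C; _∙_ to _⊕_; refl to ≈-refl; sym to ≈-sym; trans to ≈-trans)
  open Algorithm S

  module Segments (V : ℕ → C) where

    segment : ℕ → ℕ → C
    segment a zero    = V a
    segment a (suc n) = segment a n ⊕ V (suc (a + n))

    segment-++ : ∀ a m n → segment a m ⊕ segment (suc (a + m)) n ≈ segment a (suc (m + n))
    segment-++ a m zero    rewrite +-identityʳ m = ≈-refl
    segment-++ a m (suc n) rewrite +-suc m n =
      ≈-trans (≈-sym (assoc _ _ _))
        (∙-cong (segment-++ a m n) (reflexive (cong (λ i → V (suc i)) (1+[m+n+o]≡m+[1+n+o] a m n))))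

    record IsSegment (lo hi : ℕ) (x : C) : Set (c ⊔ ℓ) where
      constructor isSegment
      field
        width       : ℕ
        hi≡lo+width : hi ≡ lo + width
        x≈segment   : x ≈ segment lo width

    IsSegment-single : ∀ a → IsSegment a a (V a)
    IsSegment-single a = isSegment 0 (sym (+-identityʳ a)) ≈-refl

    IsSegment-++ : ∀ {a b d x y} → IsSegment a b x → IsSegment (suc b) d y → IsSegment a d (x ⊕ y)
    IsSegment-++ {a} (isSegment m refl x≈) (isSegment n refl y≈) =
      isSegment (suc (m + n)) (1+[m+n+o]≡m+[1+n+o] a m n) (≈-trans (∙-cong x≈ y≈) (segment-++ a m n))

    prefix≡segment : ∀ r → prefix V r ≡ segment 0 r
    prefix≡segment zero    = refl
    prefix≡segment (suc r) = cong (_⊕ V (suc r)) (prefix≡segment r)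

    -- Covers lo r w : w holds V lo ⊕ ⋯ ⊕ V (r - 1); no requirement when r = 0.
    Covers : ℕ → ℕ → Maybe C → Set (c ⊔ ℓ)
    Covers lo zero    w        = ⊤
    Covers lo (suc r) nothing  = ⊥
    Covers lo (suc r) (just x) = IsSegment lo r x

    Covers-⊕ : ∀ {a b d} u w → 0 < b → Covers a b u → Covers b d w → Covers a d (u ⊕? w)
    Covers-⊕ {d = zero}  u        w        _ _  _  = _
    Covers-⊕ {b = suc b} {suc d} (just x) (just y) _ x∈ y∈ = IsSegment-++ x∈ y∈

    Covers-snoc : ∀ {a r} w → 0 < r → Covers a r w → Covers a (suc r) (w ⊕? just (V r))
    Covers-snoc {r = r} w 0<r w∈ = Covers-⊕ w (just (V r)) 0<r w∈ (IsSegment-single r)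

    Covers-prefix : ∀ {r} w → Covers 0 (suc r) w → Pointwise _≈_ w (just (prefix V r))
    Covers-prefix (just x) (isSegment n refl x≈) = just (≈-trans x≈ (reflexive (sym (prefix≡segment n))))

    CachedPrefix : ℕ → Maybe (Maybe C) → Set (c ⊔ ℓ)
    CachedPrefix r nothing  = ⊤
    CachedPrefix r (just w) = Covers 0 (suc r) w

  module Sending (p : ℕ) where

    data InclusiveSendState (s r : ℕ) (v : C) (st : Proc) : Proc → Set c where
      unchanged : InclusiveSendState s r v st st
      counted   : InclusiveSendState s r v st (record st { ops = suc (ops st) })
      cached    : 0 < r → r < s →
                  InclusiveSendState s r v st (record st { cache = just (W st ⊕? just v) ; ops = suc (ops st) })

    sendPart-inclusive-state : ∀ s r v st → InclusiveSendState s r v st (proj₂ (sendPart inclusive p s r v st))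
    sendPart-inclusive-state s r v st with s ≤ᵇ r | ≤ᵇ-reflects-≤ s r | r + s <ᵇ p
    ... | _ | ofʸ _ | true  = counted
    ... | _ | ofʸ _ | false = unchanged
    sendPart-inclusive-state s zero    v st | _ | ofⁿ _ | true  = unchanged
    sendPart-inclusive-state s zero    v st | _ | ofⁿ _ | false = unchanged
    sendPart-inclusive-state s (suc r) v st | _ | ofⁿ _ | false = unchanged
    sendPart-inclusive-state s (suc r) v st | _ | ofⁿ s≰r | true with cache st
    ... | just _  = unchanged
    ... | nothing = cached (s≤s z≤n) (≰⇒> s≰r)

    data InclusiveMessage (s : ℕ) (v : C) (st : Proc) : ℕ → Maybe C → Set c where
      fresh  : ∀ {r} → 0 < r → InclusiveMessage s v st r (W st ⊕? just v)
      cached : ∀ {r w} → r < s → cache st ≡ just w → InclusiveMessage s v st r w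
      first  : InclusiveMessage s v st 0 (just v)

    sendPart-inclusive-message : ∀ {s} r v st → 0 < s → r + s < p →
      ∃[ w ] proj₁ (sendPart inclusive p s r v st) ≡ just (r + s , w) × InclusiveMessage s v st r w
    sendPart-inclusive-message {s} r v st 0<s r+s<p
      with s ≤ᵇ r | ≤ᵇ-reflects-≤ s r | r + s <ᵇ p | <ᵇ-reflects-< (r + s) p
    ... | _ | _       | _ | ofⁿ r+s≮p = contradiction r+s<p r+s≮p
    ... | _ | ofʸ s≤r | _ | ofʸ _     = _ , refl , fresh (≤-trans 0<s s≤r)
    sendPart-inclusive-message zero    v st _ _ | _ | ofⁿ _ | _ | ofʸ _ = _ , refl , first
    sendPart-inclusive-message (suc r) v st _ _ | _ | ofⁿ s≰r | _ | ofʸ _ with cache st in eq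
    ... | just w  = w , refl , cached (≰⇒> s≰r) eq
    ... | nothing = _ , refl , fresh (s≤s z≤n)

    sendPart-initial-state : ∀ s r v st → proj₂ (sendPart initial p s r v st) ≡ st
    sendPart-initial-state s r v st with suc r <ᵇ p
    ... | true  = refl
    ... | false = refl

    sendPart-initial-message : ∀ s r v st → suc r < p → proj₁ (sendPart initial p s r v st) ≡ just (suc r , just v)
    sendPart-initial-message s r v st r<p with suc r <ᵇ p | <ᵇ-reflects-< (suc r) p
    ... | _ | ofʸ _   = refl
    ... | _ | ofⁿ r≮p = contradiction r<p r≮p

    -- In sendPart exclusive, suc s ≤ᵇ r and 1 ≤ᵇ r reduce to s <ᵇ r and 0 <ᵇ r.
    sendPart-exclusive-state : ∀ s r v st → proj₂ (sendPart exclusive p s r v st) ≡ st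
    sendPart-exclusive-state s r v st with s <ᵇ r | r + s <ᵇ p | 0 <ᵇ r
    ... | true  | true  | _     = refl
    ... | true  | false | _     = refl
    ... | false | true  | true  = refl
    ... | false | true  | false = refl
    ... | false | false | true  = refl
    ... | false | false | false = refl

    sendPart-exclusive-message : ∀ s r v st → 0 < r → r + s < p →
      proj₁ (sendPart exclusive p s r v st) ≡ just (r + s , W st)
    sendPart-exclusive-message s (suc r) v st _ r+s<p
      with s <ᵇ suc r | suc r + s <ᵇ p | <ᵇ-reflects-< (suc r + s) p
    ... | _     | _ | ofⁿ r+s≮p = contradiction r+s<p r+s≮p
    ... | true  | _ | ofʸ _     = refl
    ... | false | _ | ofʸ _     = refl

    source-inclusive-≤ : ∀ {s r} → s ≤ r → source inclusive s r ≡ just (r ∸ s)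
    source-inclusive-≤ {s} {r} s≤r with s ≤ᵇ r | ≤ᵇ-reflects-≤ s r
    ... | _ | ofʸ _   = refl
    ... | _ | ofⁿ s≰r = contradiction s≤r s≰r

    source-inclusive-> : ∀ {s r} → r < s → source inclusive s r ≡ nothing
    source-inclusive-> {s} {r} r<s with s ≤ᵇ r | ≤ᵇ-reflects-≤ s r
    ... | _ | ofʸ s≤r = contradiction s≤r (<⇒≱ r<s)
    ... | _ | ofⁿ _   = refl

    source-exclusive-< : ∀ {s r} → s < r → source exclusive s r ≡ just (r ∸ s)
    source-exclusive-< {s} {r} s<r with s <ᵇ r | <ᵇ-reflects-< s r
    ... | _ | ofʸ _   = refl
    ... | _ | ofⁿ s≮r = contradiction s<r s≮r

    source-exclusive-≥ : ∀ {s r} → r ≤ s → source exclusive s r ≡ nothing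
    source-exclusive-≥ {s} {r} r≤s with s <ᵇ r | <ᵇ-reflects-< s r
    ... | _ | ofʸ s<r = contradiction r≤s (<⇒≱ s<r)
    ... | _ | ofⁿ _   = refl

    deliver-self : ∀ r x → deliver r (just (r , x)) ≡ x
    deliver-self zero    x = refl
    deliver-self (suc r) x = deliver-self r x

    deliver-to : ∀ {d r x} → d ≡ r → deliver r (just (d , x)) ≡ x
    deliver-to {r = r} {x} refl = deliver-self r x

  module Execution (p : ℕ) (V : ℕ → C) where
    open Segments V
    open Sending p

    sent : Phase → ℕ → (ℕ → Proc) → ℕ → Msg
    sent ph s G f = proj₁ (sendPart ph p s f (V f) (G f))

    afterSend : Phase → ℕ → (ℕ → Proc) → ℕ → Proc
    afterSend ph s G r = proj₂ (sendPart ph p s r (V r) (G r))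

    step-received : ∀ {ph s G r f} → source ph s r ≡ just f →
                    step p V (ph , s) G r ≡ recvPart ph (deliver r (sent ph s G f)) (afterSend ph s G r)
    step-received {ph} {s} {G} {r} = cong (maybe (λ f → recvPart ph (deliver r (sent ph s G f)) (afterSend ph s G r)) _)

    step-idle : ∀ {ph s G r} → source ph s r ≡ nothing → step p V (ph , s) G r ≡ afterSend ph s G r
    step-idle {ph} {s} {G} {r} = cong (maybe (λ f → recvPart ph (deliver r (sent ph s G f)) (afterSend ph s G r)) _)

    initial-step-received : ∀ {s G r} → suc r < p →
                            step p V (initial , s) G (suc r) ≡ record (G (suc r)) { W = just (V r) }
    initial-step-received {s} {G} {r} r<p =
      trans (step-received {initial} {s} {G} {suc r} refl)
        (cong₂ (λ T st → recvPart initial T st)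
          (trans (cong (deliver (suc r)) (sendPart-initial-message s r (V r) (G r) r<p)) (deliver-self (suc r) _))
          (sendPart-initial-state s (suc r) (V (suc r)) (G (suc r))))

    initial-step-idle : ∀ {s G} → step p V (initial , s) G 0 ≡ G 0
    initial-step-idle {s} {G} = trans (step-idle {initial} {s} {G} {0} refl) (sendPart-initial-state s 0 (V 0) (G 0))

    exclusive-step-received : ∀ {s G r} → s < r → r < p →
                              step p V (exclusive , s) G r ≡ recvPart exclusive (W (G (r ∸ s))) (G r)
    exclusive-step-received {s} {G} {r} s<r r<p =
      trans (step-received {exclusive} {s} {G} {r} (source-exclusive-< s<r))
        (cong₂ (λ T st → recvPart exclusive T st)
          (trans (cong (deliver r) (sendPart-exclusive-message s (r ∸ s) (V (r ∸ s)) (G (r ∸ s)) (m<n⇒0<n∸m s<r)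
                                     (subst (_< p) (sym f+s≡r) r<p)))
                 (deliver-to f+s≡r))
          (sendPart-exclusive-state s r (V r) (G r)))
      where
      f+s≡r : r ∸ s + s ≡ r
      f+s≡r = m∸n+n≡m (<⇒≤ s<r)

    exclusive-step-idle : ∀ {s G r} → r ≤ s → step p V (exclusive , s) G r ≡ G r
    exclusive-step-idle {s} {G} {r} r≤s =
      trans (step-idle {exclusive} {s} {G} {r} (source-exclusive-≥ r≤s)) (sendPart-exclusive-state s r (V r) (G r))

    InclusiveAt : ℕ → ℕ → Proc → Set (c ⊔ ℓ)
    InclusiveAt s r st = Covers (suc r ∸ s) r (W st) × CachedPrefix r (cache st)

    InclusiveInvariant : ℕ → (ℕ → Proc) → Set (c ⊔ ℓ)
    InclusiveInvariant s G = ∀ r → r < p → InclusiveAt s r (G r)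

    ExclusiveAt : ℕ → ℕ → Proc → Set (c ⊔ ℓ)
    ExclusiveAt s r st = Covers (r ∸ s) r (W st)

    ExclusiveInvariant : ℕ → (ℕ → Proc) → Set (c ⊔ ℓ)
    ExclusiveInvariant s G = ∀ r → r < p → ExclusiveAt s r (G r)

    InclusiveAt-send : ∀ {s r st st'} → InclusiveAt s r st → InclusiveSendState s r (V r) st st' →
                       InclusiveAt s r st'
    InclusiveAt-send inv unchanged = inv
    InclusiveAt-send inv counted   = inv
    InclusiveAt-send {s} {r} {st} (w∈ , _) (cached 0<r r<s) =
      w∈ , Covers-snoc (W st) 0<r (subst (λ lo → Covers lo r (W st)) (m≤n⇒m∸n≡0 r<s) w∈)

    InclusiveAt-idle : ∀ {s r st} → r < s → InclusiveAt s r st → InclusiveAt (2 * s) r st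
    InclusiveAt-idle {s} {r} {st} r<s (w∈ , c∈) =
      subst (λ lo → Covers lo r (W st)) (m≤n⇒m∸n≡m∸2*n r<s) w∈ , c∈

    InclusiveAt-receive : ∀ {s r T st} → s ≤ r → Covers (suc r ∸ 2 * s) (suc (r ∸ s)) T →
                          InclusiveAt s r st → InclusiveAt (2 * s) r (recvPart inclusive T st)
    InclusiveAt-receive {s} {r} {T} {st} s≤r T∈ (w∈ , c∈) =
      Covers-⊕ T (W st) (s≤s z≤n) T∈ (subst (λ lo → Covers lo r (W st)) (+-∸-assoc 1 s≤r) w∈) , c∈

    InclusiveMessage-covers : ∀ {s f st w} → 0 < s → InclusiveAt s f st →
                              InclusiveMessage s (V f) st f w → Covers (suc f ∸ s) (suc f) w
    InclusiveMessage-covers {st = st} _ (w∈ , _) (fresh 0<f) = Covers-snoc (W st) 0<f w∈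
    InclusiveMessage-covers {s} {f} {w = w} _ (_ , c∈) (cached f<s eq) =
      subst (λ lo → Covers lo (suc f) w) (sym (m≤n⇒m∸n≡0 f<s)) (subst (CachedPrefix f) eq c∈)
    InclusiveMessage-covers {suc s} _ _ first =
      subst (λ lo → IsSegment lo 0 (V 0)) (sym (0∸n≡0 s)) (IsSegment-single 0)

    inclusive-delivery : ∀ {s G r} → 0 < s → s ≤ r → r < p → InclusiveInvariant s G →
                         Covers (suc r ∸ 2 * s) (suc (r ∸ s)) (deliver r (sent inclusive s G (r ∸ s)))
    inclusive-delivery {s} {G} {r} 0<s s≤r r<p inv
      with sendPart-inclusive-message (r ∸ s) (V (r ∸ s)) (G (r ∸ s)) 0<s (subst (_< p) (sym (m∸n+n≡m s≤r)) r<p)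
    ... | w , sent≡ , message rewrite sent≡ | deliver-to {x = w} (m∸n+n≡m s≤r) =
      subst (λ lo → Covers lo (suc (r ∸ s)) w) lo≡
        (InclusiveMessage-covers 0<s (inv (r ∸ s) (≤-<-trans (m∸n≤m r s) r<p)) message)
      where
      lo≡ : suc (r ∸ s) ∸ s ≡ suc r ∸ 2 * s
      lo≡ = trans (cong (_∸ s) (sym (+-∸-assoc 1 s≤r))) (m∸n∸n≡m∸2*n (suc r) s)

    afterInitial : ℕ → Proc
    afterInitial = step p V (initial , 1) (λ _ → initProc)

    initial-round : InclusiveInvariant 2 afterInitial
    initial-round zero    _   = subst (InclusiveAt 2 0) (sym (initial-step-idle {1} {λ _ → initProc})) _
    initial-round (suc r) r<p =
      subst (InclusiveAt 2 (suc r)) (sym (initial-step-received {1} {λ _ → initProc} r<p)) (IsSegment-single r , _)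

    inclusive-afterSend : ∀ {s G r} → r < p → InclusiveInvariant s G → InclusiveAt s r (afterSend inclusive s G r)
    inclusive-afterSend {s} {G} {r} r<p inv =
      InclusiveAt-send {st = G r} (inv r r<p) (sendPart-inclusive-state s r (V r) (G r))

    inclusive-round : ∀ {s G} → 0 < s → InclusiveInvariant s G →
                      InclusiveInvariant (2 * s) (step p V (inclusive , s) G)
    inclusive-round {s} {G} 0<s inv r r<p with s ≤? r
    ... | no s≰r  = subst (InclusiveAt (2 * s) r)
                      (sym (step-idle {inclusive} {s} {G} {r} (source-inclusive-> (≰⇒> s≰r))))
                      (InclusiveAt-idle {st = afterSend inclusive s G r} (≰⇒> s≰r)
                        (inclusive-afterSend {s} {G} {r} r<p inv))
    ... | yes s≤r = subst (InclusiveAt (2 * s) r)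
                      (sym (step-received {inclusive} {s} {G} {r} (source-inclusive-≤ s≤r)))
                      (InclusiveAt-receive {st = afterSend inclusive s G r} s≤r
                        (inclusive-delivery {G = G} 0<s s≤r r<p inv) (inclusive-afterSend {s} {G} {r} r<p inv))

    inclusive⇒exclusive : ∀ {s G} → 0 < s → InclusiveInvariant s G → ExclusiveInvariant (s ∸ 1) G
    inclusive⇒exclusive {suc s} _ inv r r<p = proj₁ (inv r r<p)

    exclusive-round : ∀ {s G} → ExclusiveInvariant s G → ExclusiveInvariant (2 * s) (step p V (exclusive , s) G)
    exclusive-round {s} {G} inv r r<p with r ≤? s
    ... | yes r≤s = subst (ExclusiveAt (2 * s) r) (sym (exclusive-step-idle r≤s))
                      (subst (λ lo → Covers lo r (W (G r))) (m≤n⇒m∸n≡m∸2*n r≤s) (inv r r<p))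
    ... | no r≰s  = subst (ExclusiveAt (2 * s) r) (sym (exclusive-step-received s<r r<p))
                      (Covers-⊕ (W (G (r ∸ s))) (W (G r)) (m<n⇒0<n∸m s<r)
                        (subst (λ lo → Covers lo (r ∸ s) (W (G (r ∸ s)))) (m∸n∸n≡m∸2*n r s)
                          (inv (r ∸ s) (≤-<-trans (m∸n≤m r s) r<p)))
                        (inv r r<p))
      where
      s<r : s < r
      s<r = ≰⇒> r≰s

    exclusive-final : ∀ {s G} → p ∸ 1 ≤ s → ExclusiveInvariant s G →
                      ∀ r → suc r < p → Pointwise _≈_ (W (G (suc r))) (just (prefix V r))
    exclusive-final {s} {G} p∸1≤s inv r r<p =
      Covers-prefix (W (G (suc r)))
        (subst (λ lo → Covers lo (suc r) (W (G (suc r)))) (m≤n⇒m∸n≡0 (≤-trans (m<n⇒m≤n∸1 r<p) p∸1≤s))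
          (inv (suc r) r<p))

    execute : (ℕ → Proc) → List (Phase × ℕ) → (ℕ → Proc)
    execute = foldl (λ G e → step p V e G)

    execute-doublings : ∀ {a} (Inv : ℕ → (ℕ → Proc) → Set a) ph →
      (∀ {s G} → 0 < s → Inv s G → Inv (2 * s) (step p V (ph , s) G)) →
      ∀ n {s G} → 0 < s → Inv s G → Inv (2 ^ n * s) (execute G (map (ph ,_) (doublings n s)))
    execute-doublings Inv ph round zero {s} {G} _ inv = subst (λ x → Inv x G) (sym (*-identityˡ s)) inv
    execute-doublings Inv ph round (suc n) {s} {G} 0<s inv =
      subst (λ x → Inv x (execute (step p V (ph , s) G) (map (ph ,_) (doublings n (2 * s))))) (2^n*2s≡2^[1+n]*s n s)
        (execute-doublings Inv ph round n (≤-trans 0<s (m≤n*m s 2)) (round 0<s inv))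

    execute-doublingSchedule : ∀ k ne →
      execute (λ _ → initProc) (doublingSchedule k ne)
        ≡ execute (execute afterInitial (inclusiveRounds k)) (exclusiveRounds k ne)
    execute-doublingSchedule k ne = foldl-++ _ afterInitial (inclusiveRounds k) (exclusiveRounds k ne)

    doublingSchedule-correct : ∀ k ne → p ∸ 1 ≤ 2 ^ ne * (2 ^ suc k ∸ 1) →
      ∀ r → suc r < p →
      Pointwise _≈_ (W (execute (λ _ → initProc) (doublingSchedule k ne) (suc r))) (just (prefix V r))
    doublingSchedule-correct k ne p∸1≤ r r<p =
      subst (λ G → Pointwise _≈_ (W (G (suc r))) (just (prefix V r))) (sym (execute-doublingSchedule k ne))
        (exclusive-final {G = execute afterInclusive (exclusiveRounds k ne)} p∸1≤ exclusive-invariant r r<p)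
      where
      afterInclusive : ℕ → Proc
      afterInclusive = execute afterInitial (inclusiveRounds k)
      inclusive-invariant : InclusiveInvariant (2 ^ suc k) afterInclusive
      inclusive-invariant = subst (λ s → InclusiveInvariant s afterInclusive) (*-comm (2 ^ k) 2)
        (execute-doublings InclusiveInvariant inclusive inclusive-round k (s≤s z≤n) initial-round)
      exclusive-invariant : ExclusiveInvariant (2 ^ ne * (2 ^ suc k ∸ 1)) (execute afterInclusive (exclusiveRounds k ne))
      exclusive-invariant = execute-doublings ExclusiveInvariant exclusive (λ _ → exclusive-round) ne
        (m<n⇒0<n∸m (*-monoʳ-≤ 2 (m^n>0 2 k)))
        (inclusive⇒exclusive {G = afterInclusive} (m^n>0 2 (suc k)) inclusive-invariant)

    roundCost : Phase → ℕ
    roundCost initial   = 0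
    roundCost inclusive = 2
    roundCost exclusive = 1

    step-cases : ∀ ph s G r → (∃[ T ] step p V (ph , s) G r ≡ recvPart ph T (afterSend ph s G r))
                            ⊎ (step p V (ph , s) G r ≡ afterSend ph s G r)
    step-cases ph s G r = by-source (source ph s r) refl
      where
      by-source : ∀ m → source ph s r ≡ m → (∃[ T ] step p V (ph , s) G r ≡ recvPart ph T (afterSend ph s G r))
                                            ⊎ (step p V (ph , s) G r ≡ afterSend ph s G r)
      by-source (just f) eq = inj₁ (_ , step-received {ph} {s} {G} {r} eq)
      by-source nothing  eq = inj₂ (step-idle {ph} {s} {G} {r} eq)

    InclusiveSendState-ops : ∀ {s r v st st'} → InclusiveSendState s r v st st' → ops st' ≤ suc (ops st)
    InclusiveSendState-ops unchanged    = n≤1+n _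
    InclusiveSendState-ops counted      = ≤-refl
    InclusiveSendState-ops (cached _ _) = ≤-refl

    ops-step : ∀ ph s G r → ops (step p V (ph , s) G r) ≤ roundCost ph + ops (G r)
    ops-step initial s G r with step-cases initial s G r
    ... | inj₁ (_ , eq) = ≤-reflexive (trans (cong ops eq) (cong ops (sendPart-initial-state s r (V r) (G r))))
    ... | inj₂ eq       = ≤-reflexive (trans (cong ops eq) (cong ops (sendPart-initial-state s r (V r) (G r))))
    ops-step inclusive s G r with step-cases inclusive s G r
    ... | inj₁ (_ , eq) = ≤-trans (≤-reflexive (cong ops eq))
                            (s≤s (InclusiveSendState-ops (sendPart-inclusive-state s r (V r) (G r))))
    ... | inj₂ eq       = ≤-trans (≤-reflexive (cong ops eq))
                            (m≤n⇒m≤1+n (InclusiveSendState-ops (sendPart-inclusive-state s r (V r) (G r))))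
    ops-step exclusive s G r with step-cases exclusive s G r
    ... | inj₁ (_ , eq) =
      ≤-reflexive (trans (cong ops eq) (cong (λ st → suc (ops st)) (sendPart-exclusive-state s r (V r) (G r))))
    ... | inj₂ eq       =
      m≤n⇒m≤1+n (≤-reflexive (trans (cong ops eq) (cong ops (sendPart-exclusive-state s r (V r) (G r)))))

    ops-execute : ∀ ph skips G r → ops (execute G (map (ph ,_) skips) r) ≤ length skips * roundCost ph + ops (G r)
    ops-execute ph []           G r = ≤-refl
    ops-execute ph (s ∷ skips) G r = begin
      ops (execute (step p V (ph , s) G) (map (ph ,_) skips) r)  ≤⟨ ops-execute ph skips _ r ⟩
      length skips * cost + ops (step p V (ph , s) G r)           ≤⟨ +-monoʳ-≤ (length skips * cost) (ops-step ph s G r) ⟩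
      length skips * cost + (cost + ops (G r))                    ≡⟨ sym (+-assoc (length skips * cost) cost _) ⟩
      length skips * cost + cost + ops (G r)                      ≡⟨ cong (_+ ops (G r)) (+-comm (length skips * cost) cost) ⟩
      cost + length skips * cost + ops (G r)                      ∎
      where
      open ≤-Reasoning
      cost = roundCost ph

    doublingSchedule-ops : ∀ k ne r → ops (execute (λ _ → initProc) (doublingSchedule k ne) r) ≤ 2 * k + ne
    doublingSchedule-ops k ne r = begin
      ops (execute (λ _ → initProc) (doublingSchedule k ne) r)
        ≡⟨ cong (λ G → ops (G r)) (execute-doublingSchedule k ne) ⟩
      ops (execute (execute afterInitial (inclusiveRounds k)) (exclusiveRounds k ne) r)
        ≤⟨ ops-execute exclusive (doublings ne _) (execute afterInitial (inclusiveRounds k)) r ⟩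
      length (doublings ne _) * 1 + ops (execute afterInitial (inclusiveRounds k) r)
        ≤⟨ +-monoʳ-≤ _ (≤-trans (ops-execute inclusive (doublings k 2) afterInitial r)
                                (+-monoʳ-≤ _ (ops-step initial 1 (λ _ → initProc) r))) ⟩
      length (doublings ne _) * 1 + (length (doublings k 2) * 2 + 0)
        ≡⟨ cong₂ (λ a b → a * 1 + (b * 2 + 0)) (length-doublings ne _) (length-doublings k 2) ⟩
      ne * 1 + (k * 2 + 0)
        ≡⟨ regroup k ne ⟩
      2 * k + ne ∎
      where
      open ≤-Reasoning
      regroup : ∀ k ne → ne * 1 + (k * 2 + 0) ≡ 2 * k + ne
      regroup = solve-∀

proposition1 : ∀ {c ℓ} (S : Semigroup c ℓ) (p q' : ℕ) → 2 ≤ p → 1 ≤ q' → q' ≤ ⌈log₂ p ⌉ →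
    (V : ℕ → Semigroup.Carrier S) →
    (q : ℕ) → CeilLog2 (2 ^ q' * (p ∸ 1)) (2 ^ q' ∸ 1) q →
    (∀ r → suc r < p →
      Pointwise (Semigroup._≈_ S) (Algorithm.W (Algorithm.run S p q' V (suc r))) (just (Algorithm.prefix S V r)))
    × Algorithm.rounds S p q' ≡ q
    × (∀ r → r < p → Algorithm.ops (Algorithm.run S p q' V r) ≤ q + q' ∸ 2)
proposition1 S p (suc k) _ _ k<log V q q-ceil with schedule-doublingSchedule p k
... | ne , schedule≡ , ne-ceil = correct , rounds≡q , ops-bound
  where
  open Algorithm S
  open Scan.Execution S p V

  run≡ : run p (suc k) V ≡ execute (λ _ → initProc) (doublingSchedule k ne)
  run≡ = cong (execute (λ _ → initProc)) schedule≡

  q≡ : q ≡ suc k + ne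
  q≡ = CeilLog2-unique q-ceil (CeilLog2-2^* (suc k) D<2[p∸1] ne-ceil)
    where
    D<2[p∸1] : 2 ^ suc k ∸ 1 < 2 * (p ∸ 1)
    D<2[p∸1] = <-≤-trans (n∸1<n (m^n>0 2 (suc k))) (*-monoʳ-≤ 2 (m<n⇒m≤n∸1 (2^k<p {k} {p} k<log)))

  correct : ∀ r → suc r < p → Pointwise (Semigroup._≈_ S) (W (run p (suc k) V (suc r))) (just (prefix V r))
  correct r r<p rewrite run≡ = doublingSchedule-correct k ne (proj₁ ne-ceil) r r<p

  rounds≡q : rounds p (suc k) ≡ q
  rounds≡q = trans (cong length schedule≡) (trans (length-doublingSchedule k ne) (sym q≡))

  ops-bound : ∀ r → r < p → ops (run p (suc k) V r) ≤ q + suc k ∸ 2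
  ops-bound r _ rewrite run≡ | q≡ =
    subst (ops (execute (λ _ → initProc) (doublingSchedule k ne) r) ≤_) (2*k+ne≡[1+k+ne]+[1+k]∸2 k ne)
      (doublingSchedule-ops k ne r)
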